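{- Let $k$ be an even positive integer, let $s,\tilde s,f,\tilde f$ be horizontal dominoes and $b_1,\dots,b_k,b'_w,b'_0$ blocks, all with entries in a commutative ring, such that $f=h_+(b'_w)$. Then \[ \det(s b_1\cdots b_k f)\det(\tilde s b_1\cdots b_k b'_w b'_0\tilde f)-\det(\tilde s b_1\cdots b_k f)\det(s b_1\cdots b_k b'_w b'_0\tilde f) =\det\begin{bmatrix} s\\ \tilde s\end{bmatrix}\cdot\prod_{i=1}^k\det b_i\cdot\det b'_w\cdot\det\begin{bmatrix}\tilde f\\ h_+(b'_0)\end{bmatrix}. \]
   Context: A horizontal domino is a $1\times2$ matrix, a vertical domino a $2\times1$ matrix, a block a $2\times2$ matrix; $h_+(b)$ denotes the top row of a block $b$. For a sequence $X_0,\dots,X_n$ of dominoes and blocks, the DRH matrix $X_0X_1\cdots X_n$ is formed by placing the pieces successively as arrays of unit cells, each $X_t$ either directly above $X_{t-1}$ (left edges aligned) or directly to its right (bottom edges aligned), directions alternating and starting with "above" when $X_0$ is a horizontal domino; it is the bounding rectangle with the pieces' entries and $0$ elsewhere, rows read top to bottom, columns left to right (all matrices here are square). $\begin{bmatrix} u\\ u'\end{bmatrix}$ is the $2\times2$ matrix with top row $u$ and bottom row $u'$; determinants of blocks use their rows in top-to-bottom order. -}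

module Defs where

open import Level using (Level)
open import Algebra.Bundles using (CommutativeRing)
open import Data.Nat using (ℕ; zero; suc; _⊔_; _<ᵇ_; _∸_) renaming (_+_ to _+ℕ_)
open import Data.Bool using (Bool; true; false; if_then_else_; _∧_)
open import Data.Product using (_×_; _,_)
open import Data.List using (List; []; _∷_)
open import Data.Vec using (Vec; toList)
import Data.Vec as Vec

module DRH {c ℓ : Level} (R : CommutativeRing c ℓ) where
  open CommutativeRing R

  -- Pieces. Entries listed row by row, top to bottom, left to right.
  data Piece : Set c where
    hdom : Carrier → Carrier → Piece
    vdom : Carrier → Carrier → Piece
    blk  : Carrier → Carrier → Carrier → Carrier → Piece

  HDomino : Set c
  HDomino = Carrier × Carrier

  -- block = (top row , bottom row)
  Block : Set c
  Block = HDomino × HDomino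

  block : Block → Piece
  block ((a , b) , (c' , d)) = blk a b c' d

  h₊ : Block → HDomino
  h₊ (u , _) = u

  ht : Piece → ℕ
  ht (hdom _ _) = 1
  ht (vdom _ _) = 2
  ht (blk _ _ _ _) = 2

  wd : Piece → ℕ
  wd (hdom _ _) = 2
  wd (vdom _ _) = 1
  wd (blk _ _ _ _) = 2

  -- entry (i , j) of a piece, i = row from top, j = column from left
  pentry : Piece → ℕ → ℕ → Carrier
  pentry (hdom a b) 0 0 = a
  pentry (hdom a b) 0 1 = b
  pentry (vdom a b) 0 0 = a
  pentry (vdom a b) 1 0 = b
  pentry (blk a b c' d) 0 0 = a
  pentry (blk a b c' d) 0 1 = b
  pentry (blk a b c' d) 1 0 = c'
  pentry (blk a b c' d) 1 1 = d
  pentry _ _ _ = 0#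

  -- A placed piece: (x , y , p) where (x , y) is the cell coordinate of its
  -- bottom-left cell (x = column counted from the left, y = row counted from the bottom).
  Placed : Set c
  Placed = ℕ × ℕ × Piece

  -- Place the remaining pieces; 'above?' is the direction of the next piece,
  -- (x , y) bottom-left corner and (h , w) size of the previous piece.
  go : Bool → ℕ → ℕ → ℕ → ℕ → List Piece → List Placed
  go _ x y h w [] = []
  go true  x y h w (p ∷ ps) = (x , y +ℕ h , p) ∷ go false x (y +ℕ h) (ht p) (wd p) ps
  go false x y h w (p ∷ ps) = (x +ℕ w , y , p) ∷ go true (x +ℕ w) y (ht p) (wd p) ps

  -- Layout of X₀ X₁ ⋯ Xₙ with X₀ a horizontal domino (so X₁ goes above).
  layout : HDomino → List Piece → List Placed
  layout (a , b) ps = (0 , 0 , hdom a b) ∷ go true 0 0 1 2 ps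

  height : List Placed → ℕ
  height [] = 0
  height ((x , y , p) ∷ L) = (y +ℕ ht p) ⊔ height L

  width : List Placed → ℕ
  width [] = 0
  width ((x , y , p) ∷ L) = (x +ℕ wd p) ⊔ width L

  cellAt : List Placed → ℕ → ℕ → Carrier
  cellAt [] cx cy = 0#
  cellAt ((x , y , p) ∷ L) cx cy =
    if (x <ᵇ suc cx) ∧ (cx <ᵇ x +ℕ wd p) ∧ (y <ᵇ suc cy) ∧ (cy <ᵇ y +ℕ ht p)
    then pentry p ((y +ℕ ht p) ∸ suc cy) (cx ∸ x)
    else cellAt L cx cy

  -- The DRH matrix X₀X₁⋯Xₙ as an ℕ-indexed array (row r from top, column col from left),
  -- meaningful for r < height, col < width.
  drhMatrix : HDomino → List Piece → ℕ → ℕ → Carrier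
  drhMatrix s ps r col = cellAt L col (height L ∸ suc r)
    where L = layout s ps

  drhSize : HDomino → List Piece → ℕ
  drhSize s ps = height (layout s ps)

  sumTo : ℕ → (ℕ → Carrier) → Carrier
  sumTo zero f = 0#
  sumTo (suc n) f = sumTo n f + f n

  sgn : ℕ → Carrier
  sgn zero = 1#
  sgn (suc j) = - sgn j

  minor : ℕ → (ℕ → ℕ → Carrier) → ℕ → ℕ → Carrier
  minor j M i col = M (suc i) (if col <ᵇ j then col else suc col)

  det : ℕ → (ℕ → ℕ → Carrier) → Carrier
  det zero M = 1#
  det (suc n) M = sumTo (suc n) (λ j → sgn j * M 0 j * det n (minor j M))

  detDRH : HDomino → List Piece → Carrier
  detDRH s ps = det (drhSize s ps) (drhMatrix s ps)

  -- det [u ; u'] (u top row)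
  det2 : HDomino → HDomino → Carrier
  det2 (a , b) (c' , d) = a * d - b * c'

  detB : Block → Carrier
  detB (u , u') = det2 u u'

  prod : ∀ {k} → Vec Carrier k → Carrier
  prod = Vec.foldr _ _*_ 1#

  blocksThen : ∀ {k} → Vec Block k → List Piece → List Piece
  blocksThen bs rest = Data.List._++_ (toList (Vec.map block bs)) rest

  _≈H_ : HDomino → HDomino → Set ℓ
  (a , b) ≈H (a' , b') = (a ≈ a') × (b ≈ b')

  hd : HDomino → Piece
  hd (a , b) = hdom a b

-- Expanding along the top row, det(s b₁ ⋯ b₂q v) = v₀ α₁ − v₁ α₀ where α, the pair of
-- minors of the two top-row entries, depends only on s and the blocks.  Expanding those
-- minors once more along the two rows of the last pair (b, b′) shows that appending a pair
-- transforms α linearly, by a map of determinant det b · det b′; hence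
-- det2 α(s) α(s̃) = det2 s s̃ · ∏ det bᵢ.  With f = h₊(b′_w), the four determinants of the
-- corollary are all expressed through α(s) and α(s̃), and what remains is a polynomial
-- identity.
module Submission where

open import Level using (Level; _⊔_)
open import Algebra.Bundles using (CommutativeRing)
import Algebra.Solver.Ring
import Algebra.Solver.Ring.AlmostCommutativeRing as ACR
open import Data.Bool using (Bool; true; false; if_then_else_; _∧_)
open import Data.Bool.Properties using (∧-zeroʳ)
open import Data.Empty using (⊥-elim)
open import Data.Integer as ℤ using (ℤ; +_; -[1+_]; _⊖_; _◃_)
import Data.Integer.Properties as ℤ
open import Data.List using (List; []; _∷_; _++_)
open import Data.Maybe using (Maybe; just; nothing)
open import Data.Nat as ℕ using (ℕ; zero; suc; _<_; _≤_; _∸_; _<ᵇ_; z≤n; s≤s)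
open import Data.Nat.Divisibility using (_∣_; divides)
import Data.Nat.Properties as ℕ
open import Data.Product using (_×_; _,_; proj₁; proj₂)
open import Data.Sign as Sign using (Sign)
open import Data.Sum using (_⊎_; inj₁; inj₂)
open import Data.Vec as Vec using (Vec; []; _∷_; _∷ʳ_)
import Data.Vec
open import Function using (_∘_)
open import Relation.Binary.Definitions using (tri<; tri≈; tri>)
open import Relation.Binary.PropositionalEquality as ≡ using (_≡_)
import Relation.Binary.Reasoning.Setoid
open import Relation.Nullary using (yes; no)
open import Relation.Nullary.Decidable using (True; toWitness)

open import Defs

-- The ring solver normalises coefficients, so it needs a coefficient ring with decidable
-- equality mapping into R; ℤ maps into every ring.
module ℤ-Coefficients {c ℓ : Level} (R : CommutativeRing c ℓ) where
  open CommutativeRing R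
  open import Algebra.Properties.Ring ring
    using (-‿distribˡ-*; -‿distribʳ-*; -‿involutive; -0#≈0#; -‿+-comm)
  open import Algebra.Properties.Semiring.Mult semiring
    using (×-homo-+; ×1-homo-*) renaming (_×_ to _×ₙ_)
  open import Relation.Binary.Reasoning.Setoid setoid

  fromℕ : ℕ → Carrier
  fromℕ n = n ×ₙ 1#

  fromℤ : ℤ → Carrier
  fromℤ (+ n)    = fromℕ n
  fromℤ -[1+ n ] = - fromℕ (suc n)

  suc-minus-suc : ∀ a b → (1# + a) - (1# + b) ≈ a - b
  suc-minus-suc a b = begin
    (1# + a) + - (1# + b)   ≈⟨ +-congˡ (sym (-‿+-comm 1# b)) ⟩
    (1# + a) + (- 1# + - b) ≈⟨ +-congʳ (+-comm 1# a) ⟩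
    (a + 1#) + (- 1# + - b) ≈⟨ +-assoc a 1# _ ⟩
    a + (1# + (- 1# + - b)) ≈⟨ +-congˡ (sym (+-assoc 1# (- 1#) (- b))) ⟩
    a + ((1# - 1#) + - b)   ≈⟨ +-congˡ (+-congʳ (-‿inverseʳ 1#)) ⟩
    a + (0# + - b)          ≈⟨ +-congˡ (+-identityˡ (- b)) ⟩
    a - b                   ∎

  fromℤ-⊖ : ∀ m n → fromℤ (m ⊖ n) ≈ fromℕ m - fromℕ n
  fromℤ-⊖ m       zero    = sym (trans (+-congˡ -0#≈0#) (+-identityʳ _))
  fromℤ-⊖ zero    (suc n) = sym (+-identityˡ _)
  fromℤ-⊖ (suc m) (suc n) = begin
    fromℤ (suc m ⊖ suc n)         ≡⟨ ≡.cong fromℤ (ℤ.[1+m]⊖[1+n]≡m⊖n m n) ⟩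
    fromℤ (m ⊖ n)                 ≈⟨ fromℤ-⊖ m n ⟩
    fromℕ m - fromℕ n             ≈⟨ suc-minus-suc _ _ ⟨
    fromℕ (suc m) - fromℕ (suc n) ∎

  fromℤ-+ : ∀ i j → fromℤ (i ℤ.+ j) ≈ fromℤ i + fromℤ j
  fromℤ-+ (+ m)    (+ n)    = ×-homo-+ 1# m n
  fromℤ-+ (+ m)    -[1+ n ] = fromℤ-⊖ m (suc n)
  fromℤ-+ -[1+ m ] (+ n)    = trans (fromℤ-⊖ n (suc m)) (+-comm _ _)
  fromℤ-+ -[1+ m ] -[1+ n ] = begin
    - fromℕ (suc (suc m ℕ.+ n))       ≡⟨ ≡.cong (λ k → - fromℕ (suc k)) (ℕ.+-suc m n) ⟨
    - fromℕ (suc m ℕ.+ suc n)         ≈⟨ -‿cong (×-homo-+ 1# (suc m) (suc n)) ⟩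
    - (fromℕ (suc m) + fromℕ (suc n)) ≈⟨ -‿+-comm _ _ ⟨
    - fromℕ (suc m) + - fromℕ (suc n) ∎

  fromℤ-neg : ∀ i → fromℤ (ℤ.- i) ≈ - fromℤ i
  fromℤ-neg (+ zero)  = sym -0#≈0#
  fromℤ-neg (+ suc n) = refl
  fromℤ-neg -[1+ n ]  = sym (-‿involutive _)

  signed : Sign → Carrier → Carrier
  signed Sign.+ x = x
  signed Sign.- x = - x

  signed-cong : ∀ s {x y} → x ≈ y → signed s x ≈ signed s y
  signed-cong Sign.+ x≈y = x≈y
  signed-cong Sign.- x≈y = -‿cong x≈y

  signed-* : ∀ s t x y → signed (s Sign.* t) (x * y) ≈ signed s x * signed t y
  signed-* Sign.+ Sign.+ x y = refl
  signed-* Sign.+ Sign.- x y = -‿distribʳ-* x y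
  signed-* Sign.- Sign.+ x y = -‿distribˡ-* x y
  signed-* Sign.- Sign.- x y = begin
    x * y       ≈⟨ -‿involutive (x * y) ⟨
    - - (x * y) ≈⟨ -‿cong (-‿distribʳ-* x y) ⟩
    - (x * - y) ≈⟨ -‿distribˡ-* x (- y) ⟩
    - x * - y   ∎

  fromℤ-◃ : ∀ s n → fromℤ (s ◃ n) ≈ signed s (fromℕ n)
  fromℤ-◃ Sign.+ zero    = refl
  fromℤ-◃ Sign.- zero    = sym -0#≈0#
  fromℤ-◃ Sign.+ (suc n) = refl
  fromℤ-◃ Sign.- (suc n) = refl

  fromℤ-signAbs : ∀ i → fromℤ i ≈ signed (ℤ.sign i) (fromℕ ℤ.∣ i ∣)
  fromℤ-signAbs (+ n)    = refl
  fromℤ-signAbs -[1+ n ] = refl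

  fromℤ-* : ∀ i j → fromℤ (i ℤ.* j) ≈ fromℤ i * fromℤ j
  fromℤ-* i j = begin
    fromℤ (s ◃ ∣i∣ ℕ.* ∣j∣)                                       ≈⟨ fromℤ-◃ s (∣i∣ ℕ.* ∣j∣) ⟩
    signed s (fromℕ (∣i∣ ℕ.* ∣j∣))                                ≈⟨ signed-cong s (×1-homo-* ∣i∣ ∣j∣) ⟩
    signed s (fromℕ ∣i∣ * fromℕ ∣j∣)                              ≈⟨ signed-* (ℤ.sign i) (ℤ.sign j) _ _ ⟩
    signed (ℤ.sign i) (fromℕ ∣i∣) * signed (ℤ.sign j) (fromℕ ∣j∣) ≈⟨ *-cong (fromℤ-signAbs i) (fromℤ-signAbs j) ⟨
    fromℤ i * fromℤ j                                             ∎
    where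
    s = ℤ.sign i Sign.* ℤ.sign j
    ∣i∣ = ℤ.∣ i ∣
    ∣j∣ = ℤ.∣ j ∣

  homomorphism : ℤ.+-*-rawRing ACR.-Raw-AlmostCommutative⟶ ACR.fromCommutativeRing R
  homomorphism = record
    { ⟦_⟧    = fromℤ
    ; +-homo = fromℤ-+
    ; *-homo = fromℤ-*
    ; -‿homo = fromℤ-neg
    ; 0-homo = refl
    ; 1-homo = +-identityʳ 1#
    }

  fromℤ-≟ : ∀ i j → Maybe (fromℤ i ≈ fromℤ j)
  fromℤ-≟ i j with i ℤ.≟ j
  ... | yes ≡.refl = just refl
  ... | no _       = nothing

  open Algebra.Solver.Ring ℤ.+-*-rawRing (ACR.fromCommutativeRing R) homomorphism fromℤ-≟ public
    using (solve; _:=_; _:+_; _:*_; _:-_; :-_)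

module Staircase {c ℓ : Level} (R : CommutativeRing c ℓ) where
  open CommutativeRing R hiding (zero)
  open DRH R
  open ℤ-Coefficients R using (solve; _:=_; _:*_; _:-_; _:+_; :-_)
  open import Algebra.Properties.Ring ring using (-‿distribˡ-*; -‿involutive)
  module ≈-Reasoning = Relation.Binary.Reasoning.Setoid setoid

  -- Matrices indexed, like cellAt, by column and by row counted from the bottom.
  Grid : Set c
  Grid = ℕ → ℕ → Carrier

  punchIn : ℕ → ℕ → ℕ
  punchIn j x = if x <ᵇ j then x else suc x

  deleteColumn : ℕ → Grid → Grid
  deleteColumn j G x y = G (punchIn j x) y

  gridDet : ℕ → Grid → Carrier
  gridDet n G = det n (λ r x → G x (n ∸ suc r))

  -- det (suc n) expands along the top row, which is row n of the grid.
  expansionTerm : ℕ → Grid → ℕ → Carrier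
  expansionTerm n G j = sgn j * G j n * gridDet n (deleteColumn j G)

  <ᵇ-true : ∀ {m n} → m < n → (m <ᵇ n) ≡ true
  <ᵇ-true {zero}  {suc n} _         = ≡.refl
  <ᵇ-true {suc m} {suc n} (s≤s m<n) = <ᵇ-true m<n

  <ᵇ-false : ∀ {m n} → n ≤ m → (m <ᵇ n) ≡ false
  <ᵇ-false {m}     {zero}  _         = ≡.refl
  <ᵇ-false {suc m} {suc n} (s≤s n≤m) = <ᵇ-false n≤m

  punchIn-< : ∀ {j x} → x < j → punchIn j x ≡ x
  punchIn-< x<j rewrite <ᵇ-true x<j = ≡.refl

  punchIn-≥ : ∀ {j x} → j ≤ x → punchIn j x ≡ suc x
  punchIn-≥ j≤x rewrite <ᵇ-false j≤x = ≡.refl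

  punchIn-<suc : ∀ j {x n} → x < n → punchIn j x < suc n
  punchIn-<suc j {x} x<n with x <ᵇ j
  ... | true  = ℕ.m≤n⇒m≤1+n x<n
  ... | false = s≤s x<n

  ≤-punchIn : ∀ j x → x ≤ punchIn j x
  ≤-punchIn j x with x <ᵇ j
  ... | true  = ℕ.≤-refl
  ... | false = ℕ.n≤1+n x

  deleteColumn-< : ∀ G {j x} y → x < j → deleteColumn j G x y ≈ G x y
  deleteColumn-< G y x<j = reflexive (≡.cong (λ x → G x y) (punchIn-< x<j))

  sumTo-cong : ∀ n {f g} → (∀ j → j < n → f j ≈ g j) → sumTo n f ≈ sumTo n g
  sumTo-cong zero    f≈g = refl
  sumTo-cong (suc n) f≈g =
    +-cong (sumTo-cong n (λ j j<n → f≈g j (ℕ.m≤n⇒m≤1+n j<n))) (f≈g n ℕ.≤-refl)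

  sumTo-zero : ∀ n {f} → (∀ j → j < n → f j ≈ 0#) → sumTo n f ≈ 0#
  sumTo-zero zero    f≈0 = refl
  sumTo-zero (suc n) f≈0 =
    trans (+-cong (sumTo-zero n (λ j j<n → f≈0 j (ℕ.m≤n⇒m≤1+n j<n))) (f≈0 n ℕ.≤-refl))
          (+-identityʳ 0#)

  gridDet-cong : ∀ n {F G} → (∀ x y → x < n → y < n → F x y ≈ G x y) → gridDet n F ≈ gridDet n G
  gridDet-cong zero    F≈G = refl
  gridDet-cong (suc n) F≈G = sumTo-cong (suc n) λ j j≤n →
    *-cong (*-congˡ (F≈G j n j≤n ℕ.≤-refl))
      (gridDet-cong n λ x y x<n y<n → F≈G _ y (punchIn-<suc j x<n) (ℕ.m≤n⇒m≤1+n y<n))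

  gridDet-zeroColumn : ∀ n G z → z < n → (∀ y → y < n → G z y ≈ 0#) → gridDet n G ≈ 0#
  gridDet-zeroColumn (suc n) G z z<1+n Gz≈0 = sumTo-zero (suc n) term≈0
    where
    term≈0 : ∀ j → j < suc n → expansionTerm n G j ≈ 0#
    term≈0 j j≤n with ℕ.<-cmp j z
    ... | tri≈ _ ≡.refl _ =
      trans (*-congʳ (trans (*-congˡ (Gz≈0 n ℕ.≤-refl)) (zeroʳ _))) (zeroˡ _)
    ... | tri> _ _ z<j =
      trans (*-congˡ (gridDet-zeroColumn n (deleteColumn j G) z (ℕ.<-≤-trans z<j (ℕ.≤-pred j≤n))
                        λ y y<n → trans (deleteColumn-< G y z<j) (Gz≈0 y (ℕ.m≤n⇒m≤1+n y<n))))
            (zeroʳ _)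
    ... | tri< j<z _ _ = trans (*-congˡ (columnMovesLeft z j<z z<1+n Gz≈0)) (zeroʳ _)
      where
      columnMovesLeft : ∀ z → j < z → z < suc n → (∀ y → y < suc n → G z y ≈ 0#) →
                        gridDet n (deleteColumn j G) ≈ 0#
      columnMovesLeft (suc z′) (s≤s j≤z′) (s≤s z′<n) Gz≈0 =
        gridDet-zeroColumn n (deleteColumn j G) z′ z′<n λ y y<n →
          trans (reflexive (≡.cong (λ x → G x y) (punchIn-≥ j≤z′))) (Gz≈0 y (ℕ.m≤n⇒m≤1+n y<n))

  sgn-even : ∀ q → sgn (q ℕ.* 2) ≈ 1#
  sgn-even zero    = refl
  sgn-even (suc q) = trans (-‿involutive _) (sgn-even q)

  sgn-even-term : ∀ q x d → sgn (q ℕ.* 2) * x * d ≈ x * d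
  sgn-even-term q x d = *-congʳ (trans (*-congʳ (sgn-even q)) (*-identityˡ x))

  sgn-odd-term : ∀ q x d → sgn (suc (q ℕ.* 2)) * x * d ≈ - (x * d)
  sgn-odd-term q x d = begin
    - sgn (q ℕ.* 2) * x * d   ≈⟨ *-congʳ (-‿distribˡ-* _ x) ⟨
    - (sgn (q ℕ.* 2) * x) * d ≈⟨ -‿distribˡ-* _ d ⟨
    - (sgn (q ℕ.* 2) * x * d) ≈⟨ -‿cong (sgn-even-term q x d) ⟩
    - (x * d)                 ∎
    where open ≈-Reasoning

  middle-zero : ∀ a {x} d → x ≈ 0# → a * x * d ≈ 0#
  middle-zero a d x≈0 = trans (*-congʳ (trans (*-congˡ x≈0) (zeroʳ a))) (zeroˡ d)

  gridDet-topRow₂ : ∀ q G → let m = q ℕ.* 2 in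
    (∀ j → j < m → G j (suc m) ≈ 0#) →
    gridDet (suc (suc m)) G ≈ G m (suc m) * gridDet (suc m) (deleteColumn m G)
                            - G (suc m) (suc m) * gridDet (suc m) (deleteColumn (suc m) G)
  gridDet-topRow₂ q G left≈0 = begin
    (sumTo m t + t m) + t (suc m)
      ≈⟨ +-cong (+-cong (sumTo-zero m λ j j<m → middle-zero (sgn j) _ (left≈0 j j<m))
                        (sgn-even-term q _ _))
                (sgn-odd-term q _ _) ⟩
    (0# + x) - y ≈⟨ +-congʳ (+-identityˡ x) ⟩
    x - y        ∎
    where
    open ≈-Reasoning
    m = q ℕ.* 2
    t = expansionTerm (suc m) G
    x = G m (suc m) * gridDet (suc m) (deleteColumn m G)
    y = G (suc m) (suc m) * gridDet (suc m) (deleteColumn (suc m) G)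

  gridDet-topRow₃ : ∀ q G →
    let m = q ℕ.* 2 ; top = suc (suc m) ; D = λ j → gridDet top (deleteColumn j G) in
    (∀ j → j < m → G j top ≈ 0#) →
    gridDet (suc top) G ≈ (G m top * D m - G (suc m) top * D (suc m)) + G top top * D top
  gridDet-topRow₃ q G left≈0 = begin
    ((sumTo m t + t m) + t (suc m)) + t top
      ≈⟨ +-cong (+-cong (+-cong (sumTo-zero m λ j j<m → middle-zero (sgn j) _ (left≈0 j j<m))
                                (sgn-even-term q _ _))
                        (sgn-odd-term q _ _))
                (sgn-even-term (suc q) _ _) ⟩
    ((0# + x) - y) + z ≈⟨ +-congʳ (+-congʳ (+-identityˡ x)) ⟩
    (x - y) + z        ∎
    where
    open ≈-Reasoning
    m = q ℕ.* 2
    top = suc (suc m)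
    t = expansionTerm top G
    x = G m top * gridDet top (deleteColumn m G)
    y = G (suc m) top * gridDet top (deleteColumn (suc m) G)
    z = G top top * gridDet top (deleteColumn top G)

  gridDet-pivot : ∀ q H j → let m = q ℕ.* 2 ; t = suc (suc m) in m ≤ j → j ≤ suc m →
    (∀ y → y < suc m → H t y ≈ 0#) → (∀ x → x < m → H x (suc m) ≈ 0#) →
    gridDet t (deleteColumn j H) ≈ - (H t (suc m) * gridDet (suc m) (deleteColumn j H))
  gridDet-pivot q H j m≤j j≤1+m column≈0 left≈0 = begin
    gridDet t E
      ≈⟨ gridDet-topRow₂ q E E-left≈0 ⟩
    E m (suc m) * gridDet (suc m) (deleteColumn m E)
      - E (suc m) (suc m) * gridDet (suc m) (deleteColumn (suc m) E)
      ≈⟨ +-cong (*-congˡ (gridDet-zeroColumn (suc m) (deleteColumn m E) m ℕ.≤-refl E-column≈0))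
                (-‿cong (*-cong (reflexive E-pivot)
                                (gridDet-cong (suc m) λ x y x<1+m _ → deleteColumn-< E y x<1+m))) ⟩
    E m (suc m) * 0# - H t (suc m) * gridDet (suc m) E
      ≈⟨ +-congʳ (zeroʳ _) ⟩
    0# - H t (suc m) * gridDet (suc m) E
      ≈⟨ +-identityˡ _ ⟩
    - (H t (suc m) * gridDet (suc m) E)
      ∎
    where
    open ≈-Reasoning
    m = q ℕ.* 2
    t = suc (suc m)
    E = deleteColumn j H
    E-pivot : ∀ {y} → E (suc m) y ≡ H t y
    E-pivot {y} = ≡.cong (λ x → H x y) (punchIn-≥ j≤1+m)
    E-left≈0 : ∀ x → x < m → E x (suc m) ≈ 0#
    E-left≈0 x x<m = trans (deleteColumn-< H (suc m) (ℕ.<-≤-trans x<m m≤j)) (left≈0 x x<m)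
    E-column≈0 : ∀ y → y < suc m → deleteColumn m E m y ≈ 0#
    E-column≈0 y y<1+m =
      trans (reflexive (≡.trans (≡.cong (λ x → E x y) (punchIn-≥ (ℕ.≤-refl {m}))) E-pivot))
            (column≈0 y y<1+m)

  covers : Placed → ℕ → ℕ → Bool
  covers (x , y , p) cx cy = (x <ᵇ suc cx) ∧ (cx <ᵇ x ℕ.+ wd p) ∧ (y <ᵇ suc cy) ∧ (cy <ᵇ y ℕ.+ ht p)

  entryOf : Placed → ℕ → ℕ → Carrier
  entryOf (x , y , p) cx cy = pentry p ((y ℕ.+ ht p) ∸ suc cy) (cx ∸ x)

  cellAt-left : ∀ P L {cx} cy → cx < proj₁ P → cellAt (P ∷ L) cx cy ≡ cellAt L cx cy
  cellAt-left (x , y , p) L {cx} cy cx<x rewrite <ᵇ-false {x} {suc cx} cx<x = ≡.refl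

  cellAt-below : ∀ P L cx {cy} → cy < proj₁ (proj₂ P) → cellAt (P ∷ L) cx cy ≡ cellAt L cx cy
  cellAt-below (x , y , p) L cx {cy} cy<y
    rewrite <ᵇ-false {y} {suc cy} cy<y | ∧-zeroʳ (cx <ᵇ x ℕ.+ wd p) | ∧-zeroʳ (x <ᵇ suc cx) = ≡.refl

  cellAt-above : ∀ P L cx {cy} → proj₁ (proj₂ P) ℕ.+ ht (proj₂ (proj₂ P)) ≤ cy →
                 cellAt (P ∷ L) cx cy ≡ cellAt L cx cy
  cellAt-above (x , y , p) L cx {cy} top≤cy
    rewrite <ᵇ-false {cy} {y ℕ.+ ht p} top≤cy | ∧-zeroʳ (y <ᵇ suc cy)
          | ∧-zeroʳ (cx <ᵇ x ℕ.+ wd p) | ∧-zeroʳ (x <ᵇ suc cx) = ≡.refl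

  cellAt-right : ∀ P L {cx} cy → proj₁ P ℕ.+ wd (proj₂ (proj₂ P)) ≤ cx →
                 cellAt (P ∷ L) cx cy ≡ cellAt L cx cy
  cellAt-right (x , y , p) L {cx} cy right≤cx
    rewrite <ᵇ-false {cx} {x ℕ.+ wd p} right≤cx | ∧-zeroʳ (x <ᵇ suc cx) = ≡.refl

  cellAt-∷-cong : ∀ P L L′ cx cy → cellAt L cx cy ≡ cellAt L′ cx cy →
                  cellAt (P ∷ L) cx cy ≡ cellAt (P ∷ L′) cx cy
  cellAt-∷-cong P L L′ cx cy = ≡.cong (if covers P cx cy then entryOf P cx cy else_)

  cellAt-++ : ∀ L₁ L₂ cx cy → cellAt L₂ cx cy ≡ 0# → cellAt (L₁ ++ L₂) cx cy ≡ cellAt L₁ cx cy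
  cellAt-++ []       L₂ cx cy L₂≡0 = L₂≡0
  cellAt-++ (P ∷ L₁) L₂ cx cy L₂≡0 =
    cellAt-∷-cong P (L₁ ++ L₂) L₁ cx cy (cellAt-++ L₁ L₂ cx cy L₂≡0)

  shift : List Placed → List Placed
  shift []                = []
  shift ((x , y , p) ∷ L) = (suc (suc x) , suc (suc y) , p) ∷ shift L

  cellAt-shift : ∀ L cx cy → cellAt (shift L) (suc (suc cx)) (suc (suc cy)) ≡ cellAt L cx cy
  cellAt-shift []      cx cy = ≡.refl
  cellAt-shift (P ∷ L) cx cy =
    ≡.cong (if covers P cx cy then entryOf P cx cy else_) (cellAt-shift L cx cy)

  cellAt-shift-corner : ∀ L cx cy → cx < 2 ⊎ cy < 2 → cellAt (shift L) cx cy ≡ 0#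
  cellAt-shift-corner []                cx cy _           = ≡.refl
  cellAt-shift-corner ((x , y , p) ∷ L) cx cy (inj₁ cx<2) =
    ≡.trans (cellAt-left (suc (suc x) , suc (suc y) , p) (shift L) cy (ℕ.<-≤-trans cx<2 (s≤s (s≤s z≤n))))
            (cellAt-shift-corner L cx cy (inj₁ cx<2))
  cellAt-shift-corner ((x , y , p) ∷ L) cx cy (inj₂ cy<2) =
    ≡.trans (cellAt-below (suc (suc x) , suc (suc y) , p) (shift L) cx (ℕ.<-≤-trans cy<2 (s≤s (s≤s z≤n))))
            (cellAt-shift-corner L cx cy (inj₂ cy<2))

  BlockPair : Set c
  BlockPair = Block × Block

  -- The pieces b₁ ⋯ b₂q v placed as in DRH(s b₁ ⋯ b₂q v), but i pairs further up the staircase.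
  stairFrom : ℕ → ∀ {q} → Vec BlockPair q → HDomino → List Placed
  stairFrom i []              v = (i ℕ.* 2 , suc (i ℕ.* 2) , hd v) ∷ []
  stairFrom i ((b , b′) ∷ ps) v =
    (i ℕ.* 2 , suc (i ℕ.* 2) , block b) ∷ (suc (suc (i ℕ.* 2)) , suc (i ℕ.* 2) , block b′) ∷
    stairFrom (suc i) ps v

  stairFrom-suc : ∀ i {q} (ps : Vec BlockPair q) v → stairFrom (suc i) ps v ≡ shift (stairFrom i ps v)
  stairFrom-suc i []              v = ≡.refl
  stairFrom-suc i ((b , b′) ∷ ps) v = ≡.cong (λ L → _ ∷ _ ∷ L) (stairFrom-suc (suc i) ps v)

  0₂ : HDomino
  0₂ = 0# , 0#

  cells : ∀ {q} → HDomino → Vec BlockPair q → HDomino → Grid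
  cells s ps v = cellAt ((0 , 0 , hd s) ∷ stairFrom 0 ps v)

  cornerCells : HDomino → Block → Block → Grid
  cornerCells s b b′ = cellAt ((0 , 0 , hd s) ∷ (0 , 1 , block b) ∷ (2 , 1 , block b′) ∷ [])

  cells-corner : ∀ {q} s b b′ (ps : Vec BlockPair q) v x y → x < 2 ⊎ y < 2 →
                 cells s ((b , b′) ∷ ps) v x y ≡ cornerCells s b b′ x y
  cells-corner s b b′ ps v x y corner =
    ≡.trans (≡.cong (λ L → cellAt (P₀ ∷ P₁ ∷ P₂ ∷ L) x y) (stairFrom-suc 0 ps v))
            (cellAt-++ (P₀ ∷ P₁ ∷ P₂ ∷ []) (shift (stairFrom 0 ps v)) x y
                       (cellAt-shift-corner (stairFrom 0 ps v) x y corner))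
    where
    P₀ = (0 , 0 , hd s)
    P₁ = (0 , 1 , block b)
    P₂ = (2 , 1 , block b′)

  pentry-topRow : ∀ a b c′ d y x → pentry (blk a b c′ d) (0 ∸ y) x ≡ pentry (hdom a b) (0 ∸ y) x
  pentry-topRow a b c′ d zero    zero          = ≡.refl
  pentry-topRow a b c′ d zero    (suc zero)    = ≡.refl
  pentry-topRow a b c′ d zero    (suc (suc x)) = ≡.refl
  pentry-topRow a b c′ d (suc y) zero          = ≡.refl
  pentry-topRow a b c′ d (suc y) (suc zero)    = ≡.refl
  pentry-topRow a b c′ d (suc y) (suc (suc x)) = ≡.refl

  -- Past the first pair the picture repeats, the top row of b′ playing the role of s.
  cells-inner : ∀ {q} s b b′ (ps : Vec BlockPair q) v x y →
                cells s ((b , b′) ∷ ps) v (suc (suc x)) (suc (suc y)) ≡ cells (h₊ b′) ps v x y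
  cells-inner s b ((d₀₀ , d₀₁) , (d₁₀ , d₁₁)) ps v x y =
    ≡.cong₂ (if (x <ᵇ 2) ∧ (y <ᵇ 1) then_else_) (pentry-topRow d₀₀ d₀₁ d₁₀ d₁₁ y x)
      (≡.trans (≡.cong (λ L → cellAt L (suc (suc x)) (suc (suc y))) (stairFrom-suc 0 ps v))
               (cellAt-shift (stairFrom 0 ps v) x y))

  cornerCells-upperLeft : ∀ s b b′ x y → x < 2 → 3 ≤ y → cornerCells s b b′ x y ≡ 0#
  cornerCells-upperLeft s b b′ x y x<2 3≤y =
    ≡.trans (cellAt-above (0 , 0 , hd s) ((0 , 1 , block b) ∷ (2 , 1 , block b′) ∷ []) x
                          (ℕ.≤-trans (s≤s z≤n) 3≤y))
    (≡.trans (cellAt-above (0 , 1 , block b) ((2 , 1 , block b′) ∷ []) x 3≤y)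
             (cellAt-left (2 , 1 , block b′) [] y x<2))

  cornerCells-right : ∀ s b b′ x y → 4 ≤ x → cornerCells s b b′ x y ≡ 0#
  cornerCells-right s b b′ x y 4≤x =
    ≡.trans (cellAt-right (0 , 0 , hd s) ((0 , 1 , block b) ∷ (2 , 1 , block b′) ∷ []) y 2≤x)
    (≡.trans (cellAt-right (0 , 1 , block b) ((2 , 1 , block b′) ∷ []) y 2≤x)
             (cellAt-right (2 , 1 , block b′) [] y 4≤x))
    where 2≤x = ℕ.≤-trans (s≤s (s≤s z≤n)) 4≤x

  data Position : ℕ → ℕ → Set where
    corner : ∀ {x y} → x < 2 ⊎ y < 2 → Position x y
    inner  : ∀ x y → Position (suc (suc x)) (suc (suc y))

  position : ∀ x y → Position x y
  position zero          y             = corner (inj₁ (s≤s z≤n))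
  position (suc zero)    y             = corner (inj₁ (s≤s (s≤s z≤n)))
  position (suc (suc x)) zero          = corner (inj₂ (s≤s z≤n))
  position (suc (suc x)) (suc zero)    = corner (inj₂ (s≤s (s≤s z≤n)))
  position (suc (suc x)) (suc (suc y)) = inner x y

  s<s⁻¹₂ : ∀ {m n} → suc (suc m) < suc (suc n) → m < n
  s<s⁻¹₂ lt = ℕ.s<s⁻¹ (ℕ.s<s⁻¹ lt)

  cells-∷ʳ-belowTop : ∀ {q} s (ps : Vec BlockPair q) p u v x y → y < suc (q ℕ.* 2) →
                      cells s (ps ∷ʳ p) u x y ≡ cells s ps v x y
  cells-∷ʳ-belowTop s [] (b , b′) u v x zero _ =
    cellAt-∷-cong (0 , 0 , hd s) (stairFrom 0 ((b , b′) ∷ []) u) (stairFrom 0 [] v) x 0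
      (≡.trans (cellAt-below (0 , 1 , block b) ((2 , 1 , block b′) ∷ (2 , 3 , hd u) ∷ []) x (s≤s z≤n))
      (≡.trans (cellAt-below (2 , 1 , block b′) ((2 , 3 , hd u) ∷ []) x (s≤s z≤n))
      (≡.trans (cellAt-below (2 , 3 , hd u) [] x (s≤s z≤n))
               (≡.sym (cellAt-below (0 , 1 , hd v) [] x (s≤s z≤n))))))
  cells-∷ʳ-belowTop s [] p u v x (suc y) (s≤s ())
  cells-∷ʳ-belowTop s ((b , b′) ∷ ps) p u v x y y<top with position x y
  ... | corner c    =
    ≡.trans (cells-corner s b b′ (ps ∷ʳ p) u x y c) (≡.sym (cells-corner s b b′ ps v x y c))
  ... | inner x′ y′ =
    ≡.trans (cells-inner s b b′ (ps ∷ʳ p) u x′ y′)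
    (≡.trans (cells-∷ʳ-belowTop (h₊ b′) ps p u v x′ y′ (s<s⁻¹₂ y<top))
             (≡.sym (cells-inner s b b′ ps v x′ y′)))

  cells-belowTop : ∀ {q} s (ps : Vec BlockPair q) v v′ x y → y < suc (q ℕ.* 2) →
                   cells s ps v x y ≡ cells s ps v′ x y
  cells-belowTop s ps v v′ x y y<top =
    ≡.trans (≡.sym (cells-∷ʳ-belowTop s ps p₀ 0₂ v x y y<top)) (cells-∷ʳ-belowTop s ps p₀ 0₂ v′ x y y<top)
    where p₀ = (0₂ , 0₂) , (0₂ , 0₂)

  cells-aboveStair : ∀ {q} i s (ps : Vec BlockPair q) v x y → x < i ℕ.* 2 → i ℕ.* 2 < y →
                     cells s ps v x y ≡ 0#
  cells-aboveStair (suc i) s [] v x y _ 2i<y =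
    ≡.trans (cellAt-above (0 , 0 , hd s) ((0 , 1 , hd v) ∷ []) x (ℕ.≤-trans (s≤s z≤n) 2i<y))
            (cellAt-above (0 , 1 , hd v) [] x (ℕ.≤-trans (s≤s (s≤s z≤n)) 2i<y))
  cells-aboveStair (suc i) s ((b , b′) ∷ ps) v x y x<2i 2i<y with position x y
  ... | corner (inj₁ x<2) =
    ≡.trans (cells-corner s b b′ ps v x y (inj₁ x<2))
            (cornerCells-upperLeft s b b′ x y x<2 (ℕ.≤-trans (s≤s (s≤s (s≤s z≤n))) 2i<y))
  ... | corner (inj₂ y<2) = ⊥-elim (ℕ.<-asym y<2 (ℕ.≤-trans (s≤s (s≤s (s≤s z≤n))) 2i<y))
  ... | inner x′ y′       =
    ≡.trans (cells-inner s b b′ ps v x′ y′)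
            (cells-aboveStair i (h₊ b′) ps v x′ y′ (s<s⁻¹₂ x<2i) (s<s⁻¹₂ 2i<y))

  cells-rightOfStair : ∀ {q} s (ps : Vec BlockPair q) v x y →
                       suc (suc (q ℕ.* 2)) ≤ x → y < suc (q ℕ.* 2) → cells s ps v x y ≡ 0#
  cells-rightOfStair s [] v x zero 2≤x _ =
    ≡.trans (cellAt-right (0 , 0 , hd s) ((0 , 1 , hd v) ∷ []) 0 2≤x)
            (cellAt-below (0 , 1 , hd v) [] x (s≤s z≤n))
  cells-rightOfStair s [] v x (suc y) _ (s≤s ())
  cells-rightOfStair s ((b , b′) ∷ ps) v x y right≤x y<top with position x y
  ... | corner c    =
    ≡.trans (cells-corner s b b′ ps v x y c)
            (cornerCells-right s b b′ x y (ℕ.≤-trans (s≤s (s≤s (s≤s (s≤s z≤n)))) right≤x))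
  ... | inner x′ y′ =
    ≡.trans (cells-inner s b b′ ps v x′ y′)
            (cells-rightOfStair (h₊ b′) ps v x′ y′ (ℕ.s≤s⁻¹ (ℕ.s≤s⁻¹ right≤x)) (s<s⁻¹₂ y<top))

  topEdge : ∀ {q} → HDomino → Vec BlockPair q → HDomino
  topEdge s []              = s
  topEdge s ((b , b′) ∷ ps) = topEdge (h₊ b′) ps

  cells-shifted : ∀ {q} s (ps : Vec BlockPair q) v x y →
                  cells s ps v (q ℕ.* 2 ℕ.+ x) (q ℕ.* 2 ℕ.+ y) ≡ cells (topEdge s ps) [] v x y
  cells-shifted s []              v x y = ≡.refl
  cells-shifted {suc q} s ((b , b′) ∷ ps) v x y =
    ≡.trans (cells-inner s b b′ ps v (q ℕ.* 2 ℕ.+ x) (q ℕ.* 2 ℕ.+ y)) (cells-shifted (h₊ b′) ps v x y)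

  cells-∷ʳ-shifted : ∀ {q} s (ps : Vec BlockPair q) p u x y →
                     cells s (ps ∷ʳ p) u (q ℕ.* 2 ℕ.+ x) (q ℕ.* 2 ℕ.+ y) ≡ cells (topEdge s ps) (p ∷ []) u x y
  cells-∷ʳ-shifted s []              p u x y = ≡.refl
  cells-∷ʳ-shifted {suc q} s ((b , b′) ∷ ps) p u x y =
    ≡.trans (cells-inner s b b′ (ps ∷ʳ p) u (q ℕ.* 2 ℕ.+ x) (q ℕ.* 2 ℕ.+ y))
            (cells-∷ʳ-shifted (h₊ b′) ps p u x y)

  transferStep : HDomino → BlockPair → HDomino
  transferStep α ((u , u′) , ((d₀₀ , d₀₁) , (d₁₀ , d₁₁))) =
    d₀₀ * det2 u′ α - d₁₀ * det2 u α , d₀₁ * det2 u′ α - d₁₁ * det2 u α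

  transfer : ∀ {q} → HDomino → Vec BlockPair q → HDomino
  transfer s []       = s
  transfer s (p ∷ ps) = transfer (transferStep s p) ps

  transfer-∷ʳ : ∀ {q} s (ps : Vec BlockPair q) p → transfer s (ps ∷ʳ p) ≡ transferStep (transfer s ps) p
  transfer-∷ʳ s []        p = ≡.refl
  transfer-∷ʳ s (p′ ∷ ps) p = transfer-∷ʳ (transferStep s p′) ps p

  det2-congˡ : ∀ {a a′} b → a ≈H a′ → det2 a b ≈ det2 a′ b
  det2-congˡ b (a₀≈ , a₁≈) = +-cong (*-congʳ a₀≈) (-‿cong (*-congʳ a₁≈))

  AgreesBelowTop : ∀ {q} → HDomino → Vec BlockPair q → Grid → Set ℓ
  AgreesBelowTop {q} s ps G =
    ∀ x y → x < suc (suc (q ℕ.* 2)) → y < suc (q ℕ.* 2) → G x y ≈ cells s ps 0₂ x y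

  -- The minors of the two top-row entries of cells s ps v, read off any G agreeing with it below.
  TopMinors : ∀ {q} → HDomino → Vec BlockPair q → Set (c ⊔ ℓ)
  TopMinors {q} s ps = ∀ G → AgreesBelowTop s ps G → let m = q ℕ.* 2 in
    gridDet (suc m) (deleteColumn m G) ≈ proj₂ (transfer s ps) ×
    gridDet (suc m) (deleteColumn (suc m) G) ≈ proj₁ (transfer s ps)

  gridDet-byTransfer : ∀ {q} s (ps : Vec BlockPair q) → TopMinors s ps → ∀ F → let m = q ℕ.* 2 in
    AgreesBelowTop s ps F → (∀ x → x < m → F x (suc m) ≈ 0#) →
    gridDet (suc (suc m)) F ≈ det2 (F m (suc m) , F (suc m) (suc m)) (transfer s ps)
  gridDet-byTransfer {q} s ps minors F agrees left≈0 =
    trans (gridDet-topRow₂ q F left≈0)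
          (+-cong (*-congˡ (proj₁ (minors F agrees))) (-‿cong (*-congˡ (proj₂ (minors F agrees)))))

  pairStep-identity : ∀ u₀ u₁ a₀ a₁ h g W →
    (u₀ * - (h * a₁) - u₁ * - (h * a₀)) + g * W ≈ g * W - h * (u₀ * a₁ - u₁ * a₀)
  pairStep-identity = solve 7 (λ u₀ u₁ a₀ a₁ h g W →
    (u₀ :* (:- (h :* a₁)) :- u₁ :* (:- (h :* a₀))) :+ g :* W
      := g :* W :- h :* (u₀ :* a₁ :- u₁ :* a₀)) refl

  gridDet-pairStep : ∀ {q} s (ps : Vec BlockPair q) → TopMinors s ps →
    ∀ H u u′ → let m = q ℕ.* 2 ; t = suc (suc m) ; α = transfer s ps in
    AgreesBelowTop s ps H →
    (∀ y → y < suc m → H t y ≈ 0#) →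
    (∀ x → x < m → H x (suc m) ≈ 0# × H x t ≈ 0#) →
    (H m t , H (suc m) t) ≈H u → (H m (suc m) , H (suc m) (suc m)) ≈H u′ →
    gridDet (suc t) H ≈ H t t * det2 u′ α - H t (suc m) * det2 u α
  gridDet-pairStep {q} s ps minors H (u₀ , u₁) u′ agrees column≈0 rows≈0 (u₀≈ , u₁≈) u′≈ = begin
    gridDet (suc t) H
      ≈⟨ gridDet-topRow₃ q H (λ x x<m → proj₂ (rows≈0 x x<m)) ⟩
    (H m t * D m - H (suc m) t * D (suc m)) + H t t * D t
      ≈⟨ +-cong (+-cong (*-cong u₀≈ D-m) (-‿cong (*-cong u₁≈ D-1+m))) (*-congˡ D-t) ⟩
    (u₀ * - (h * proj₂ α) - u₁ * - (h * proj₁ α)) + H t t * det2 u′ α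
      ≈⟨ pairStep-identity u₀ u₁ (proj₁ α) (proj₂ α) h (H t t) (det2 u′ α) ⟩
    H t t * det2 u′ α - h * det2 (u₀ , u₁) α
      ∎
    where
    open ≈-Reasoning
    m = q ℕ.* 2
    t = suc (suc m)
    α = transfer s ps
    h = H t (suc m)
    D = λ j → gridDet t (deleteColumn j H)
    left≈0 : ∀ x → x < m → H x (suc m) ≈ 0#
    left≈0 x x<m = proj₁ (rows≈0 x x<m)
    D-m : D m ≈ - (h * proj₂ α)
    D-m = trans (gridDet-pivot q H m ℕ.≤-refl (ℕ.n≤1+n m) column≈0 left≈0)
                (-‿cong (*-congˡ (proj₁ (minors H agrees))))
    D-1+m : D (suc m) ≈ - (h * proj₁ α)
    D-1+m = trans (gridDet-pivot q H (suc m) (ℕ.n≤1+n m) ℕ.≤-refl column≈0 left≈0)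
                  (-‿cong (*-congˡ (proj₂ (minors H agrees))))
    below : ∀ {x} y → x < t → deleteColumn t H x y ≈ H x y
    below y x<t = deleteColumn-< H y x<t
    D-t : D t ≈ det2 u′ α
    D-t = trans (gridDet-byTransfer s ps minors (deleteColumn t H)
                   (λ x y x<t y<1+m → trans (below y x<t) (agrees x y x<t y<1+m))
                   (λ x x<m → trans (below (suc m) (ℕ.m<n⇒m<1+n (ℕ.m<n⇒m<1+n x<m))) (left≈0 x x<m)))
                (det2-congˡ α (trans (below (suc m) (ℕ.m<n⇒m<1+n (ℕ.n<1+n m))) (proj₁ u′≈) ,
                               trans (below (suc m) (ℕ.n<1+n (suc m))) (proj₂ u′≈)))

  topMinors-[] : ∀ s → TopMinors s []
  topMinors-[] s G agrees = entry 1 (s≤s (s≤s z≤n)) , entry 0 (s≤s z≤n)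
    where
    entry : ∀ x → x < 2 → 0# + 1# * G x 0 * 1# ≈ cells s [] 0₂ x 0
    entry x x<2 =
      trans (+-identityˡ _) (trans (*-identityʳ _) (trans (*-identityˡ _) (agrees x 0 x<2 (s≤s z≤n))))

  module _ {q} (s : HDomino) (ps : Vec BlockPair q) (p : BlockPair) (G : Grid)
           (agrees : AgreesBelowTop s (ps ∷ʳ p) G) where
    private
      m = q ℕ.* 2

    agrees-lower : AgreesBelowTop s ps G
    agrees-lower x y x<2+m y<1+m =
      trans (agrees x y (ℕ.m<n⇒m<1+n (ℕ.m<n⇒m<1+n x<2+m)) (ℕ.m<n⇒m<1+n (ℕ.m<n⇒m<1+n y<1+m)))
            (reflexive (cells-∷ʳ-belowTop s ps p 0₂ 0₂ x y y<1+m))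

    agrees-right : ∀ x y → suc (suc m) ≤ x → x < 4 ℕ.+ m → y < suc m → G x y ≈ 0#
    agrees-right x y 2+m≤x x<4+m y<1+m =
      trans (agrees x y x<4+m (ℕ.m<n⇒m<1+n (ℕ.m<n⇒m<1+n y<1+m)))
            (reflexive (≡.trans (cells-∷ʳ-belowTop s ps p 0₂ 0₂ x y y<1+m)
                                (cells-rightOfStair s ps 0₂ x y 2+m≤x y<1+m)))

    agrees-upperLeft : ∀ x y → x < m → m < y → y < 3 ℕ.+ m → G x y ≈ 0#
    agrees-upperLeft x y x<m m<y y<3+m =
      trans (agrees x y (ℕ.<-≤-trans x<m (ℕ.m≤n+m m 4)) y<3+m)
            (reflexive (cells-aboveStair q s (ps ∷ʳ p) 0₂ x y x<m m<y))

    agrees-lastPair : ∀ a r → a < 4 → r < 3 →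
                      G (a ℕ.+ m) (r ℕ.+ m) ≈ cells (topEdge s ps) (p ∷ []) 0₂ a r
    agrees-lastPair a r a<4 r<3 =
      trans (agrees (a ℕ.+ m) (r ℕ.+ m) (ℕ.+-monoˡ-< m a<4) (ℕ.+-monoˡ-< m r<3))
            (reflexive (≡.trans (≡.cong₂ (cells s (ps ∷ʳ p) 0₂) (ℕ.+-comm a m) (ℕ.+-comm r m))
                                (cells-∷ʳ-shifted s ps p 0₂ a r)))

  topMinors-∷ʳ : ∀ {q} s (ps : Vec BlockPair q) p → TopMinors s ps → TopMinors s (ps ∷ʳ p)
  topMinors-∷ʳ {q} s ps p@((u , u′) , ((d₀₀ , d₀₁) , (d₁₀ , d₁₁))) minors G agrees
    rewrite transfer-∷ʳ s ps p =
      minorAt t (punchIn-≥ (ℕ.≤-refl {t})) ℕ.≤-refl (lastPair 3 2 , lastPair 3 1) ,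
      minorAt (suc t) (punchIn-< (ℕ.n<1+n t)) (ℕ.n≤1+n t) (lastPair 2 2 , lastPair 2 1)
    where
    m = q ℕ.* 2
    t = suc (suc m)
    α = transfer s ps
    lastPair : ∀ a r {a<4 : True (a ℕ.<? 4)} {r<3 : True (r ℕ.<? 3)} →
               G (a ℕ.+ m) (r ℕ.+ m) ≈ cells (topEdge s ps) (p ∷ []) 0₂ a r
    lastPair a r {a<4} {r<3} = agrees-lastPair s ps p G agrees a r (toWitness a<4) (toWitness r<3)
    minorAt : ∀ j {k e₀ e₁} → punchIn j t ≡ k → t ≤ j → (G k t , G k (suc m)) ≈H (e₀ , e₁) →
              gridDet (suc t) (deleteColumn j G) ≈ e₀ * det2 u′ α - e₁ * det2 u α
    minorAt j ≡.refl t≤j (e₀≈ , e₁≈) =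
      trans (gridDet-pairStep s ps minors (deleteColumn j G) u u′ lower column rows
               (trans (kept m t m<j) (lastPair 0 2) , trans (kept (suc m) t 1+m<j) (lastPair 1 2))
               (trans (kept m (suc m) m<j) (lastPair 0 1) , trans (kept (suc m) (suc m) 1+m<j) (lastPair 1 1)))
            (+-cong (*-congʳ e₀≈) (-‿cong (*-congʳ e₁≈)))
      where
      1+m<j = ℕ.<-≤-trans (ℕ.n<1+n (suc m)) t≤j
      m<j = ℕ.<-trans (ℕ.n<1+n m) 1+m<j
      kept : ∀ x y → x < j → deleteColumn j G x y ≈ G x y
      kept x y x<j = deleteColumn-< G y x<j
      lower : AgreesBelowTop s ps (deleteColumn j G)
      lower x y x<t y<1+m =
        trans (kept x y (ℕ.<-≤-trans x<t t≤j)) (agrees-lower s ps p G agrees x y x<t y<1+m)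
      column : ∀ y → y < suc m → deleteColumn j G t y ≈ 0#
      column y y<1+m = agrees-right s ps p G agrees (punchIn j t) y
                         (≤-punchIn j t) (punchIn-<suc j (ℕ.n<1+n t)) y<1+m
      rows : ∀ x → x < m → deleteColumn j G x (suc m) ≈ 0# × deleteColumn j G x t ≈ 0#
      rows x x<m =
        trans (kept x (suc m) x<j)
              (agrees-upperLeft s ps p G agrees x (suc m) x<m m<1+m (ℕ.<-trans 1+m<t t<3+m)) ,
        trans (kept x t x<j)
              (agrees-upperLeft s ps p G agrees x t x<m (ℕ.<-trans m<1+m 1+m<t) t<3+m)
        where
        x<j = ℕ.<-trans x<m m<j
        m<1+m = ℕ.n<1+n m
        1+m<t = ℕ.n<1+n (suc m)
        t<3+m = ℕ.n<1+n t

  topMinors : ∀ q s (ps : Vec BlockPair q) → TopMinors s ps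
  topMinors zero    s [] = topMinors-[] s
  topMinors (suc q) s ps with Vec.initLast ps
  ... | ps′ , p , ≡.refl = topMinors-∷ʳ s ps′ p (topMinors q s ps′)

  cells-topRow : ∀ {q} s (ps : Vec BlockPair q) v a → let m = q ℕ.* 2 in
                 cells s ps v (a ℕ.+ m) (suc m) ≡ cells (topEdge s ps) [] v a 1
  cells-topRow {q} s ps v a =
    ≡.trans (≡.cong₂ (cells s ps v) (ℕ.+-comm a m) (ℕ.+-comm 1 m)) (cells-shifted s ps v a 1)
    where m = q ℕ.* 2

  gridDet-cells : ∀ {q} s (ps : Vec BlockPair q) v →
                  gridDet (suc (suc (q ℕ.* 2))) (cells s ps v) ≈ det2 v (transfer s ps)
  gridDet-cells {q} s ps v =
    trans (gridDet-byTransfer s ps (topMinors q s ps) (cells s ps v)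
             (λ x y _ y<1+m → reflexive (cells-belowTop s ps v 0₂ x y y<1+m))
             (λ x x<m → reflexive (cells-aboveStair q s ps v x (suc m) x<m (ℕ.n<1+n m))))
          (det2-congˡ (transfer s ps) (reflexive (cells-topRow s ps v 0) , reflexive (cells-topRow s ps v 1)))
    where m = q ℕ.* 2

  pieces : ∀ {q} → Vec BlockPair q → List Piece
  pieces []              = []
  pieces ((b , b′) ∷ ps) = block b ∷ block b′ ∷ pieces ps

  go-pieces : ∀ i {q} (ps : Vec BlockPair q) v {x y h w} → x ≡ i ℕ.* 2 → y ℕ.+ h ≡ suc (i ℕ.* 2) →
              go true x y h w (pieces ps ++ hd v ∷ []) ≡ stairFrom i ps v
  go-pieces i []              v ≡.refl y+h≡ rewrite y+h≡ = ≡.refl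
  go-pieces i ((b , b′) ∷ ps) v ≡.refl y+h≡ rewrite y+h≡ =
    ≡.cong₂ (λ x L → (i ℕ.* 2 , suc (i ℕ.* 2) , block b) ∷ (x , suc (i ℕ.* 2) , block b′) ∷ L)
      (ℕ.+-comm (i ℕ.* 2) 2)
      (go-pieces (suc i) ps v (ℕ.+-comm (i ℕ.* 2) 2) (ℕ.+-comm (suc (i ℕ.* 2)) 2))

  height-stairFrom : ∀ i {q} (ps : Vec BlockPair q) v →
                     height (stairFrom i ps v) ≡ suc (suc (i ℕ.* 2 ℕ.+ q ℕ.* 2))
  height-stairFrom i [] v =
    ≡.trans (ℕ.⊔-identityʳ _)
    (≡.trans (ℕ.+-comm (suc (i ℕ.* 2)) 1) (≡.cong (suc ∘ suc) (≡.sym (ℕ.+-identityʳ (i ℕ.* 2)))))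
  height-stairFrom i {suc q} ((b , b′) ∷ ps) v = begin
    a ℕ.⊔ (a ℕ.⊔ height (stairFrom (suc i) ps v)) ≡⟨ ≡.cong (λ n → a ℕ.⊔ (a ℕ.⊔ n)) (height-stairFrom (suc i) ps v) ⟩
    a ℕ.⊔ (a ℕ.⊔ B)                              ≡⟨ ≡.cong (a ℕ.⊔_) (ℕ.m≤n⇒m⊔n≡n a≤B) ⟩
    a ℕ.⊔ B                                      ≡⟨ ℕ.m≤n⇒m⊔n≡n a≤B ⟩
    B                                            ≡⟨ ≡.cong (suc ∘ suc) i*2+2+q*2 ⟨
    suc (suc (i ℕ.* 2 ℕ.+ suc q ℕ.* 2))          ∎
    where
    open ≡.≡-Reasoning
    a = suc (i ℕ.* 2) ℕ.+ 2
    B = suc (suc (suc (suc (i ℕ.* 2 ℕ.+ q ℕ.* 2))))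
    a≤B : a ≤ B
    a≤B = ℕ.≤-trans (ℕ.≤-reflexive (ℕ.+-comm (suc (i ℕ.* 2)) 2))
                    (s≤s (s≤s (s≤s (ℕ.≤-trans (ℕ.m≤m+n (i ℕ.* 2) (q ℕ.* 2)) (ℕ.n≤1+n _)))))
    i*2+2+q*2 : i ℕ.* 2 ℕ.+ suc (suc (q ℕ.* 2)) ≡ suc (suc (i ℕ.* 2 ℕ.+ q ℕ.* 2))
    i*2+2+q*2 = ≡.trans (ℕ.+-suc (i ℕ.* 2) _) (≡.cong suc (ℕ.+-suc (i ℕ.* 2) _))

  detDRH-transfer : ∀ {q} s (ps : Vec BlockPair q) v →
                    detDRH s (pieces ps ++ hd v ∷ []) ≈ det2 v (transfer s ps)
  detDRH-transfer s ps v =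
    trans (reflexive (≡.cong (λ L → gridDet (height L) (cellAt L)) layout≡))
    (trans (reflexive (≡.cong (λ n → gridDet (1 ℕ.⊔ n) (cells s ps v)) (height-stairFrom 0 ps v)))
           (gridDet-cells s ps v))
    where
    layout≡ : layout s (pieces ps ++ hd v ∷ []) ≡ (0 , 0 , hd s) ∷ stairFrom 0 ps v
    layout≡ = ≡.cong ((0 , 0 , hd s) ∷_) (go-pieces 0 ps v ≡.refl ≡.refl)

  pairUp : ∀ q → Vec Block (q ℕ.* 2) → Vec BlockPair q
  pairUp zero    []            = []
  pairUp (suc q) (b ∷ b′ ∷ bs) = (b , b′) ∷ pairUp q bs

  blocksThen-pairUp : ∀ q (bs : Vec Block (q ℕ.* 2)) r → blocksThen bs r ≡ pieces (pairUp q bs) ++ r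
  blocksThen-pairUp zero    []            r = ≡.refl
  blocksThen-pairUp (suc q) (b ∷ b′ ∷ bs) r =
    ≡.cong (λ L → block b ∷ block b′ ∷ L) (blocksThen-pairUp q bs r)

  pieces-∷ʳ : ∀ {q} (ps : Vec BlockPair q) b b′ r →
              pieces (ps ∷ʳ (b , b′)) ++ r ≡ pieces ps ++ block b ∷ block b′ ∷ r
  pieces-∷ʳ []              b b′ r = ≡.refl
  pieces-∷ʳ ((c , c′) ∷ ps) b b′ r = ≡.cong (λ L → block c ∷ block c′ ∷ L) (pieces-∷ʳ ps b b′ r)

  detDRH-blocksThen : ∀ q s (bs : Vec Block (q ℕ.* 2)) v →
    detDRH s (blocksThen bs (hd v ∷ [])) ≈ det2 v (transfer s (pairUp q bs))
  detDRH-blocksThen q s bs v =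
    trans (reflexive (≡.cong (detDRH s) (blocksThen-pairUp q bs _))) (detDRH-transfer s (pairUp q bs) v)

  detDRH-blocksThen-pair : ∀ q s (bs : Vec Block (q ℕ.* 2)) b b′ v →
    detDRH s (blocksThen bs (block b ∷ block b′ ∷ hd v ∷ []))
      ≈ det2 v (transferStep (transfer s (pairUp q bs)) (b , b′))
  detDRH-blocksThen-pair q s bs b b′ v =
    trans (reflexive (≡.cong (detDRH s) (≡.trans (blocksThen-pairUp q bs _) (≡.sym (pieces-∷ʳ ps b b′ _)))))
    (trans (detDRH-transfer s (ps ∷ʳ (b , b′)) v)
           (reflexive (≡.cong (det2 v) (transfer-∷ʳ s ps (b , b′)))))
    where ps = pairUp q bs

  det2-transferStep : ∀ a a′ b b′ →
    det2 (transferStep a (b , b′)) (transferStep a′ (b , b′)) ≈ det2 a a′ * (detB b * detB b′)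
  det2-transferStep (a₀ , a₁) (a₀′ , a₁′) ((c₀₀ , c₀₁) , (c₁₀ , c₁₁)) ((d₀₀ , d₀₁) , (d₁₀ , d₁₁)) =
    solve 12 (λ a₀ a₁ a₀′ a₁′ c₀₀ c₀₁ c₁₀ c₁₁ d₀₀ d₀₁ d₁₀ d₁₁ →
      let X  = c₁₀ :* a₁ :- c₁₁ :* a₀   ; Y  = c₀₀ :* a₁ :- c₀₁ :* a₀
          X′ = c₁₀ :* a₁′ :- c₁₁ :* a₀′ ; Y′ = c₀₀ :* a₁′ :- c₀₁ :* a₀′
      in (d₀₀ :* X :- d₁₀ :* Y) :* (d₀₁ :* X′ :- d₁₁ :* Y′) :- (d₀₁ :* X :- d₁₁ :* Y) :* (d₀₀ :* X′ :- d₁₀ :* Y′)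
         := (a₀ :* a₁′ :- a₁ :* a₀′) :* ((c₀₀ :* c₁₁ :- c₀₁ :* c₁₀) :* (d₀₀ :* d₁₁ :- d₀₁ :* d₁₀)))
      refl a₀ a₁ a₀′ a₁′ c₀₀ c₀₁ c₁₀ c₁₁ d₀₀ d₀₁ d₁₀ d₁₁

  det2-transfer : ∀ q s s′ (bs : Vec Block (q ℕ.* 2)) →
    det2 (transfer s (pairUp q bs)) (transfer s′ (pairUp q bs)) ≈ det2 s s′ * prod (Vec.map detB bs)
  det2-transfer zero    s s′ []            = sym (*-identityʳ _)
  det2-transfer (suc q) s s′ (b ∷ b′ ∷ bs) = begin
    det2 (transfer a ps) (transfer a′ ps)
      ≈⟨ det2-transfer q a a′ bs ⟩
    det2 a a′ * prod (Vec.map detB bs)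
      ≈⟨ *-congʳ (det2-transferStep s s′ b b′) ⟩
    det2 s s′ * (detB b * detB b′) * prod (Vec.map detB bs)
      ≈⟨ trans (*-assoc _ _ _) (*-congˡ (*-assoc _ _ _)) ⟩
    det2 s s′ * (detB b * (detB b′ * prod (Vec.map detB bs)))
      ∎
    where
    open ≈-Reasoning
    ps = pairUp q bs
    a = transferStep s (b , b′)
    a′ = transferStep s′ (b , b′)

  det2-exchange : ∀ a a′ w b₀ g →
    det2 (h₊ w) a * det2 g (transferStep a′ (w , b₀)) - det2 (h₊ w) a′ * det2 g (transferStep a (w , b₀))
      ≈ det2 a a′ * detB w * det2 g (h₊ b₀)
  det2-exchange (a₀ , a₁) (a₀′ , a₁′) ((w₀₀ , w₀₁) , (w₁₀ , w₁₁)) ((e₀₀ , e₀₁) , (e₁₀ , e₁₁)) (g₀ , g₁) =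
    solve 14 (λ a₀ a₁ a₀′ a₁′ w₀₀ w₀₁ w₁₀ w₁₁ e₀₀ e₀₁ e₁₀ e₁₁ g₀ g₁ →
      let X  = w₁₀ :* a₁ :- w₁₁ :* a₀   ; Y  = w₀₀ :* a₁ :- w₀₁ :* a₀
          X′ = w₁₀ :* a₁′ :- w₁₁ :* a₀′ ; Y′ = w₀₀ :* a₁′ :- w₀₁ :* a₀′
      in (w₀₀ :* a₁ :- w₀₁ :* a₀) :* (g₀ :* (e₀₁ :* X′ :- e₁₁ :* Y′) :- g₁ :* (e₀₀ :* X′ :- e₁₀ :* Y′))
         :- (w₀₀ :* a₁′ :- w₀₁ :* a₀′) :* (g₀ :* (e₀₁ :* X :- e₁₁ :* Y) :- g₁ :* (e₀₀ :* X :- e₁₀ :* Y))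
         := (a₀ :* a₁′ :- a₁ :* a₀′) :* (w₀₀ :* w₁₁ :- w₀₁ :* w₁₀) :* (g₀ :* e₀₁ :- g₁ :* e₀₀))
      refl a₀ a₁ a₀′ a₁′ w₀₀ w₀₁ w₁₀ w₁₁ e₀₀ e₀₁ e₁₀ e₁₁ g₀ g₁

corollary7p11 : ∀ {c ℓ : Level} (R : CommutativeRing c ℓ) (k : ℕ) → 1 ≤ k → 2 ∣ k →
    let open CommutativeRing R
        open DRH R
    in (s s~ f f~ : HDomino) (bs : Vec Block k) (bw b0 : Block) →
       f ≈H h₊ bw →
       detDRH s (blocksThen bs (hd f ∷ []))
         * detDRH s~ (blocksThen bs (block bw ∷ block b0 ∷ hd f~ ∷ []))
         - detDRH s~ (blocksThen bs (hd f ∷ []))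
         * detDRH s (blocksThen bs (block bw ∷ block b0 ∷ hd f~ ∷ []))
         ≈ det2 s s~ * prod (Data.Vec.map detB bs) * detB bw * det2 f~ (h₊ b0)
corollary7p11 R k _ (divides q ≡.refl) s s~ f f~ bs bw b0 f≈h₊bw = begin
  detDRH s F * detDRH s~ F′ - detDRH s~ F * detDRH s F′
    ≈⟨ +-cong (*-cong (withF s) (withF′ s~)) (-‿cong (*-cong (withF s~) (withF′ s))) ⟩
  det2 (h₊ bw) α * det2 f~ (transferStep α~ (bw , b0)) - det2 (h₊ bw) α~ * det2 f~ (transferStep α (bw , b0))
    ≈⟨ det2-exchange α α~ bw b0 f~ ⟩
  det2 α α~ * detB bw * det2 f~ (h₊ b0)
    ≈⟨ *-congʳ (*-congʳ (det2-transfer q s s~ bs)) ⟩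
  det2 s s~ * prod (Vec.map detB bs) * detB bw * det2 f~ (h₊ b0)
    ∎
  where
  open CommutativeRing R
  open DRH R
  open Staircase R
  open ≈-Reasoning
  F = blocksThen bs (hd f ∷ [])
  F′ = blocksThen bs (block bw ∷ block b0 ∷ hd f~ ∷ [])
  transferOf : HDomino → HDomino
  transferOf t = transfer t (pairUp q bs)
  α = transferOf s
  α~ = transferOf s~
  withF : ∀ t → detDRH t F ≈ det2 (h₊ bw) (transferOf t)
  withF t = trans (detDRH-blocksThen q t bs f) (det2-congˡ _ f≈h₊bw)
  withF′ : ∀ t → detDRH t F′ ≈ det2 f~ (transferStep (transferOf t) (bw , b0))
  withF′ t = detDRH-blocksThen-pair q t bs bw b0 f~
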